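{- Let $q$ be even and let $\psi:\mathbb{Z}_q\to\{ -1,+1\}$ satisfy $\psi(0)=1$ and the functional equation $$\psi(x)\psi(y)\psi(z)=\psi\!\left(\frac{4xyz-x-y-z}{4(xy+yz+zx)-1}\right)\quad\text{for all }x,y,z\in\mathbb{Z}_q\text{ with }\gcd(4(xy+yz+zx)-1,q)=1.$$ Then there exists $r\in\{0,1\}$ such that the function $x\mapsto\psi(x)(-1)^{rx}$ also satisfies this functional equation and is periodic with period $q/2$.
   Context: $\mathbb{Z}_q=\mathbb{Z}/q\mathbb{Z}$; the quotient means multiplication by the inverse in $\mathbb{Z}_q$. Since $q$ is even, $(-1)^{x}$ is well defined for $x\in\mathbb{Z}_q$. -}

module Defs where

open import Data.Nat as ℕ using (ℕ; zero; suc; NonZero; _/_)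
open import Data.Nat.DivMod using (_mod_)
open import Data.Fin using (Fin; toℕ)
open import Data.Integer as ℤ using (ℤ; +_; _-_; _*_; _+_)
open import Data.Integer.GCD using (gcd)
open import Data.Integer.Divisibility using (_∣_)
open import Data.Sign as Sign using (Sign)
open import Relation.Binary.PropositionalEquality using (_≡_)

-- Z_q is represented by Fin q (canonical residues 0 … q-1);
-- ⟦ x ⟧ is the integer representative of a residue.
⟦_⟧ : ∀ {q} → Fin q → ℤ
⟦ x ⟧ = + toℕ x

-- {-1,+1} is represented by Data.Sign.Sign (with multiplication Sign._*_).

negOnePow : ℕ → Sign
negOnePow zero = Sign.+
negOnePow (suc n) = Sign.- Sign.* negOnePow n

den : ℤ → ℤ → ℤ → ℤ
den x y z = + 4 * (x * y + y * z + z * x) - + 1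

num : ℤ → ℤ → ℤ → ℤ
num x y z = + 4 * x * y * z - x - y - z

-- The element num · den⁻¹ of Z_q is
-- characterised as the (unique, since den is a unit) w ∈ Z_q with
-- den · w ≡ num (mod q).
FunEq : (q : ℕ) → (Fin q → Sign) → Set
FunEq q ψ =
  (x y z w : Fin q) →
  gcd (den ⟦ x ⟧ ⟦ y ⟧ ⟦ z ⟧) (+ q) ≡ + 1 →
  (+ q) ∣ (den ⟦ x ⟧ ⟦ y ⟧ ⟦ z ⟧ * ⟦ w ⟧ - num ⟦ x ⟧ ⟦ y ⟧ ⟦ z ⟧) →
  ψ x Sign.* ψ y Sign.* ψ z ≡ ψ w

Periodic-half : (q : ℕ) .{{_ : NonZero q}} → (Fin q → Sign) → Set
Periodic-half q ψ = (x : Fin q) → ψ ((toℕ x ℕ.+ q / 2) mod q) ≡ ψ x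

twist : ∀ {q} → ℕ → (Fin q → Sign) → (Fin q → Sign)
twist r ψ x = ψ x Sign.* negOnePow (r ℕ.* toℕ x)

-- Taking (x, q/2, 0) in the functional equation gives ψ(x + q/2) = ψ(x) ψ(q/2), so ψ has
-- period q/2 as soon as ψ(q/2) = 1.  The parity character x ↦ (-1)^x also solves the
-- equation (its denominator is odd, so the solution w has the parity of x + y + z), hence so
-- does every twist of ψ, and the twist by (-1)^x changes the value at q/2 by (-1)^(q/2).  If
-- ψ(q/2) = -1 then q/2 is odd: for q/2 = 2k the triple (0, k, k) would give ψ(q/2) = ψ(k)² = 1.
module Submission where

open import Defs
open import Data.Empty using (⊥-elim)
open import Data.Fin using (Fin; toℕ)
open import Data.Fin.Properties using (toℕ-fromℕ<)
open import Data.Integer as ℤ using (+_; -_; _+_; _-_; _*_)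
import Data.Integer.Properties as ℤ
open import Data.Integer.Divisibility.Signed as ℤ∣ using (divides) renaming (_∣_ to _∣ℤ_)
open import Data.Integer.GCD using (gcd; gcd[i,j]∣i; gcd[i,j]∣j)
open import Data.Integer.Tactic.RingSolver using (solve-∀)
open import Data.Nat as ℕ using (ℕ; NonZero; _≤_; zero; suc; z≤n; s≤s)
import Data.Nat.Properties as ℕ
open import Data.Nat.Divisibility as ℕ∣ using (_∣_)
open import Data.Nat.DivMod using (_mod_; _/_; _divMod_; DivMod; m%n<n; m<n⇒m%n≡m; m/n<m; m/n*n≡m)
open import Data.Product using (∃-syntax; _×_; _,_)
open import Data.Sign as Sign using (Sign)
import Data.Sign.Properties as Sign
open import Algebra.Properties.CommutativeSemigroup Sign.*-commutativeSemigroup using (interchange)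
open import Data.Sum using (_⊎_; inj₁; inj₂)
open import Relation.Nullary using (¬_)
open import Relation.Binary.PropositionalEquality
open ≡-Reasoning

even-or-odd : ∀ n → ∃[ k ] (n ≡ k ℕ.+ k ⊎ n ≡ suc (k ℕ.+ k))
even-or-odd zero = 0 , inj₁ refl
even-or-odd (suc n) with even-or-odd n
... | k , inj₁ n≡k+k   = k , inj₂ (cong suc n≡k+k)
... | k , inj₂ n≡1+k+k = suc k , inj₁ (cong suc (trans n≡1+k+k (sym (ℕ.+-suc k k))))

negOnePow-+ : ∀ m n → negOnePow (m ℕ.+ n) ≡ negOnePow m Sign.* negOnePow n
negOnePow-+ zero    n = refl
negOnePow-+ (suc m) n =
  trans (cong (Sign.- Sign.*_) (negOnePow-+ m n)) (sym (Sign.*-assoc Sign.- (negOnePow m) (negOnePow n)))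

negOnePow-double : ∀ k → negOnePow (k ℕ.+ k) ≡ Sign.+
negOnePow-double k = trans (negOnePow-+ k k) (Sign.s*s≡+ (negOnePow k))

2∤±1 : ∀ {z} → ℤ.∣ z ∣ ≡ 1 → ¬ (+ 2 ∣ℤ z)
2∤±1 ∣z∣≡1 2∣z with ℕ∣.∣1⇒≡1 (subst (2 ∣_) ∣z∣≡1 (ℤ∣.∣⇒∣ᵤ 2∣z))
... | ()

negOnePow-cong : ∀ m n → + 2 ∣ℤ + m - + n → negOnePow m ≡ negOnePow n
negOnePow-cong zero          zero          _   = refl
negOnePow-cong zero          (suc zero)    2∣  = ⊥-elim (2∤±1 refl 2∣)
negOnePow-cong (suc zero)    zero          2∣  = ⊥-elim (2∤±1 refl 2∣)
negOnePow-cong (suc zero)    (suc zero)    _   = refl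
negOnePow-cong (suc (suc m)) n             2∣  =
  trans (Sign.opposite-involutive (negOnePow m))
        (negOnePow-cong m n (ℤ∣.∣m+n∣n⇒∣m (subst (+ 2 ∣ℤ_) (shift (+ m) (+ n)) 2∣) ℤ∣.∣-refl))
  where
  shift : ∀ a b → (+ 2 + a) - b ≡ (a - b) + + 2
  shift = solve-∀
negOnePow-cong m             (suc (suc n)) 2∣  =
  trans (negOnePow-cong m n (subst (+ 2 ∣ℤ_) (shift (+ m) (+ n)) (ℤ∣.∣m∣n⇒∣m+n 2∣ ℤ∣.∣-refl)))
        (sym (Sign.opposite-involutive (negOnePow n)))
  where
  shift : ∀ a b → (a - (+ 2 + b)) + + 2 ≡ a - b
  shift = solve-∀

negOnePow-*-cong : ∀ r {m n} → + 2 ∣ℤ + m - + n → negOnePow (r ℕ.* m) ≡ negOnePow (r ℕ.* n)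
negOnePow-*-cong r {m} {n} 2∣ = negOnePow-cong (r ℕ.* m) (r ℕ.* n) (subst (+ 2 ∣ℤ_) r*[m-n] (ℤ∣.∣n⇒∣m*n (+ r) 2∣))
  where
  distrib : ∀ a b c → a * (b - c) ≡ a * b - a * c
  distrib = solve-∀
  r*[m-n] : + r * (+ m - + n) ≡ + (r ℕ.* m) - + (r ℕ.* n)
  r*[m-n] = trans (distrib (+ r) (+ m) (+ n)) (sym (cong₂ _-_ (ℤ.pos-* r m) (ℤ.pos-* r n)))

module _ {q : ℕ} .{{_ : NonZero q}} where

  toℕ-mod : ∀ {m} → m ℕ.< q → toℕ (m mod q) ≡ m
  toℕ-mod {m} m<q = trans (toℕ-fromℕ< (m%n<n m q)) (m<n⇒m%n≡m m<q)

  ⟦mod⟧≡ : ∀ {m} → m ℕ.< q → ⟦ m mod q ⟧ ≡ + m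
  ⟦mod⟧≡ m<q = cong +_ (toℕ-mod m<q)

  ⟦mod⟧-residue : ∀ m → + q ∣ℤ + m - ⟦ m mod q ⟧
  ⟦mod⟧-residue m = divides (+ (m / q)) (begin
    + m - + r                          ≡⟨ cong (λ n → + n - + r) (DivMod.property (m divMod q)) ⟩
    + (r ℕ.+ m / q ℕ.* q) - + r        ≡⟨ cong (_- + r) (trans (ℤ.pos-+ r _) (cong (_+_ (+ r)) (ℤ.pos-* (m / q) q))) ⟩
    + r + + (m / q) * + q - + r        ≡⟨ cancel (+ r) _ ⟩
    + (m / q) * + q                    ∎)
    where
    r : ℕ
    r = toℕ (m mod q)
    cancel : ∀ a b → a + b - a ≡ b
    cancel = solve-∀

  0<q : 0 ℕ.< q
  0<q = ℕ.>-nonZero⁻¹ q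

  q/2<q : q / 2 ℕ.< q
  q/2<q = m/n<m q 2 (s≤s (s≤s z≤n))

  twist-at-half : ∀ r (ψ : Fin q → Sign) →
    twist r ψ (q / 2 mod q) ≡ ψ (q / 2 mod q) Sign.* negOnePow (r ℕ.* (q / 2))
  twist-at-half r ψ = cong (λ n → ψ (q / 2 mod q) Sign.* negOnePow (r ℕ.* n)) (toℕ-mod q/2<q)

  twist-at-0 : ∀ {ψ : Fin q → Sign} → ψ (0 mod q) ≡ Sign.+ → ∀ r → twist r ψ (0 mod q) ≡ Sign.+
  twist-at-0 {ψ} ψ0 r = begin
    ψ (0 mod q) Sign.* negOnePow (r ℕ.* toℕ (0 mod q)) ≡⟨ cong (λ n → ψ (0 mod q) Sign.* negOnePow (r ℕ.* n)) (toℕ-mod 0<q) ⟩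
    ψ (0 mod q) Sign.* negOnePow (r ℕ.* 0)             ≡⟨ cong (λ n → ψ (0 mod q) Sign.* negOnePow n) (ℕ.*-zeroʳ r) ⟩
    ψ (0 mod q) Sign.* Sign.+                          ≡⟨ Sign.*-identityʳ _ ⟩
    ψ (0 mod q)                                        ≡⟨ ψ0 ⟩
    Sign.+                                             ∎

∣d+1⇒gcd≡1 : ∀ d {m} → m ∣ℤ d + + 1 → gcd d m ≡ + 1
∣d+1⇒gcd≡1 d {m} m∣d+1 = cong +_ (ℕ∣.∣1⇒≡1 (ℤ∣.∣⇒∣ᵤ g∣1))
  where
  g∣1 : gcd d m ∣ℤ + 1
  g∣1 = ℤ∣.∣m+n∣m⇒∣n {m = d} (ℤ∣.∣-trans (ℤ∣.∣ᵤ⇒∣ (gcd[i,j]∣j d m)) m∣d+1) (ℤ∣.∣ᵤ⇒∣ (gcd[i,j]∣i d m))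

-- -1 is its own inverse, so num · den⁻¹ ≡ -num when den ≡ -1 (mod q).
FunEq-den≡-1 : ∀ {q} {ψ : Fin q → Sign} → FunEq q ψ → ∀ x y z w →
  + q ∣ℤ den ⟦ x ⟧ ⟦ y ⟧ ⟦ z ⟧ + + 1 → + q ∣ℤ ⟦ w ⟧ + num ⟦ x ⟧ ⟦ y ⟧ ⟦ z ⟧ →
  ψ x Sign.* ψ y Sign.* ψ z ≡ ψ w
FunEq-den≡-1 {q} ψ-eq x y z w q∣den+1 q∣w+num =
  ψ-eq x y z w (∣d+1⇒gcd≡1 (den ⟦ x ⟧ ⟦ y ⟧ ⟦ z ⟧) q∣den+1)
    (ℤ∣.∣⇒∣ᵤ (subst (+ q ∣ℤ_) (sym (split (den ⟦ x ⟧ ⟦ y ⟧ ⟦ z ⟧) (num ⟦ x ⟧ ⟦ y ⟧ ⟦ z ⟧) ⟦ w ⟧))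
                       (ℤ∣.∣m∣n⇒∣m-n (ℤ∣.∣m⇒∣m*n ⟦ w ⟧ q∣den+1) q∣w+num)))
  where
  split : ∀ d n w → d * w - n ≡ (d + + 1) * w - (w + n)
  split = solve-∀

FunEq-* : ∀ {q} {ψ χ : Fin q → Sign} → FunEq q ψ → FunEq q χ → FunEq q (λ x → ψ x Sign.* χ x)
FunEq-* {ψ = ψ} {χ} ψ-eq χ-eq x y z w gcd≡1 q∣ = begin
  (ψ x · χ x) · (ψ y · χ y) · (ψ z · χ z) ≡⟨ cong (_· (ψ z · χ z)) (interchange (ψ x) (χ x) (ψ y) (χ y)) ⟩
  (ψ x · ψ y) · (χ x · χ y) · (ψ z · χ z) ≡⟨ interchange (ψ x · ψ y) (χ x · χ y) (ψ z) (χ z) ⟩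
  (ψ x · ψ y · ψ z) · (χ x · χ y · χ z)   ≡⟨ cong₂ _·_ (ψ-eq x y z w gcd≡1 q∣) (χ-eq x y z w gcd≡1 q∣) ⟩
  ψ w · χ w                               ∎
  where
  infixl 7 _·_
  _·_ : Sign → Sign → Sign
  _·_ = Sign._*_

sum≡solution-mod-2 : ∀ x y z w → + 2 ∣ℤ den x y z * w - num x y z → + 2 ∣ℤ (x + y + z) - w
sum≡solution-mod-2 x y z w 2∣ =
  subst (+ 2 ∣ℤ_) (sym (identity x y z w)) (ℤ∣.∣m∣n⇒∣m-n 2∣ (divides (+ 2 * ((x * y + y * z + z * x) * w - x * y * z)) refl))
  where
  -- den and num are written out: the ring solver does not unfold definitions.
  identity : ∀ x y z w → (x + y + z) - w ≡
    ((+ 4 * (x * y + y * z + z * x) - + 1) * w - (+ 4 * x * y * z - x - y - z))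
      - (+ 2 * ((x * y + y * z + z * x) * w - x * y * z)) * + 2
  identity = solve-∀

FunEq-negOnePow : ∀ {q} → 2 ∣ q → ∀ r → FunEq q (λ x → negOnePow (r ℕ.* toℕ x))
FunEq-negOnePow {q} 2∣q r x y z w _ q∣ = begin
  negOnePow (r ℕ.* a) Sign.* negOnePow (r ℕ.* b) Sign.* negOnePow (r ℕ.* c)
    ≡⟨ cong (Sign._* negOnePow (r ℕ.* c)) (negOnePow-+ (r ℕ.* a) (r ℕ.* b)) ⟨
  negOnePow (r ℕ.* a ℕ.+ r ℕ.* b) Sign.* negOnePow (r ℕ.* c)
    ≡⟨ negOnePow-+ (r ℕ.* a ℕ.+ r ℕ.* b) (r ℕ.* c) ⟨
  negOnePow (r ℕ.* a ℕ.+ r ℕ.* b ℕ.+ r ℕ.* c)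
    ≡⟨ cong negOnePow (trans (ℕ.*-distribˡ-+ r (a ℕ.+ b) c) (cong (ℕ._+ r ℕ.* c) (ℕ.*-distribˡ-+ r a b))) ⟨
  negOnePow (r ℕ.* (a ℕ.+ b ℕ.+ c))
    ≡⟨ negOnePow-*-cong r (sum≡solution-mod-2 (+ a) (+ b) (+ c) ⟦ w ⟧ (ℤ∣.∣-trans (ℤ∣.∣ᵤ⇒∣ {i = + q} 2∣q) (ℤ∣.∣ᵤ⇒∣ q∣))) ⟩
  negOnePow (r ℕ.* toℕ w) ∎
  where
  a b c : ℕ
  a = toℕ x
  b = toℕ y
  c = toℕ z

FunEq-twist : ∀ {q} {ψ : Fin q → Sign} → 2 ∣ q → FunEq q ψ → ∀ r → FunEq q (twist r ψ)
FunEq-twist 2∣q ψ-eq r = FunEq-* ψ-eq (FunEq-negOnePow 2∣q r)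

module _ {q : ℕ} .{{_ : NonZero q}} (2∣q : 2 ∣ q) where

  private
    q≡2[q/2] : + q ≡ + (q / 2) * + 2
    q≡2[q/2] = trans (cong +_ (sym (m/n*n≡m 2∣q))) (ℤ.pos-* (q / 2) 2)

  shift-half : ∀ {χ : Fin q → Sign} → FunEq q χ → χ (0 mod q) ≡ Sign.+ → ∀ x →
    χ ((toℕ x ℕ.+ q / 2) mod q) ≡ χ x Sign.* χ (q / 2 mod q)
  shift-half {χ} χ-eq χ0 x = begin
    χ w                                  ≡⟨ FunEq-den≡-1 χ-eq x h 0F w den≡-1 w≡x+h ⟨
    χ x Sign.* χ h Sign.* χ 0F           ≡⟨ cong (χ x Sign.* χ h Sign.*_) χ0 ⟩
    χ x Sign.* χ h Sign.* Sign.+         ≡⟨ Sign.*-identityʳ _ ⟩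
    χ x Sign.* χ h                       ∎
    where
    h 0F : Fin q
    h  = q / 2 mod q
    0F = 0 mod q
    w : Fin q
    w  = (toℕ x ℕ.+ q / 2) mod q
    den+1 : ∀ X H → (+ 4 * (X * H + H * + 0 + + 0 * X) - + 1) + + 1 ≡ (+ 2 * X) * (H * + 2)
    den+1 = solve-∀
    w+num : ∀ X H W → W + (+ 4 * X * H * + 0 - X - H - + 0) ≡ - ((X + H) - W)
    w+num = solve-∀
    den≡-1 : + q ∣ℤ den ⟦ x ⟧ ⟦ h ⟧ ⟦ 0F ⟧ + + 1
    den≡-1 = subst₂ (λ H Z → + q ∣ℤ den ⟦ x ⟧ H Z + + 1) (sym (⟦mod⟧≡ q/2<q)) (sym (⟦mod⟧≡ 0<q))
      (divides (+ 2 * ⟦ x ⟧) (trans (den+1 ⟦ x ⟧ (+ (q / 2))) (cong (+ 2 * ⟦ x ⟧ *_) (sym q≡2[q/2]))))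
    w≡x+h : + q ∣ℤ ⟦ w ⟧ + num ⟦ x ⟧ ⟦ h ⟧ ⟦ 0F ⟧
    w≡x+h = subst₂ (λ H Z → + q ∣ℤ ⟦ w ⟧ + num ⟦ x ⟧ H Z) (sym (⟦mod⟧≡ q/2<q)) (sym (⟦mod⟧≡ 0<q))
      (subst (+ q ∣ℤ_) (sym (w+num ⟦ x ⟧ (+ (q / 2)) ⟦ w ⟧)) (ℤ∣.∣m⇒∣-m (⟦mod⟧-residue (toℕ x ℕ.+ q / 2))))

  χ[q/2]≡+⇒Periodic-half : ∀ {χ : Fin q → Sign} → FunEq q χ → χ (0 mod q) ≡ Sign.+ →
    χ (q / 2 mod q) ≡ Sign.+ → Periodic-half q χ
  χ[q/2]≡+⇒Periodic-half {χ} χ-eq χ0 χh x =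
    trans (shift-half χ-eq χ0 x) (trans (cong (χ x Sign.*_) χh) (Sign.*-identityʳ (χ x)))

  q/2-even⇒ψ[q/2]≡+ : ∀ {ψ : Fin q → Sign} → FunEq q ψ → ψ (0 mod q) ≡ Sign.+ →
    ∀ k → q / 2 ≡ k ℕ.+ k → ψ (q / 2 mod q) ≡ Sign.+
  q/2-even⇒ψ[q/2]≡+ {ψ} ψ-eq ψ0 k h≡k+k = begin
    ψ h                                  ≡⟨ FunEq-den≡-1 ψ-eq 0F kF kF h den≡-1 h≡2k ⟨
    ψ 0F Sign.* ψ kF Sign.* ψ kF         ≡⟨ cong (λ s → s Sign.* ψ kF Sign.* ψ kF) ψ0 ⟩
    ψ kF Sign.* ψ kF                     ≡⟨ Sign.s*s≡+ (ψ kF) ⟩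
    Sign.+                               ∎
    where
    h 0F : Fin q
    h  = q / 2 mod q
    0F = 0 mod q
    kF : Fin q
    kF = k mod q
    k<q : k ℕ.< q
    k<q = ℕ.≤-<-trans (subst (k ≤_) (sym h≡k+k) (ℕ.m≤m+n k k)) q/2<q
    q≡2[k+k] : + q ≡ (+ k + + k) * + 2
    q≡2[k+k] = trans q≡2[q/2] (cong (λ n → + n * + 2) h≡k+k)
    den+1 : ∀ K → (+ 4 * (+ 0 * K + K * K + K * + 0) - + 1) + + 1 ≡ K * ((K + K) * + 2)
    den+1 = solve-∀
    h+num : ∀ K Q → (K + K) + (+ 4 * + 0 * K * K - + 0 - K - K) ≡ + 0 * Q
    h+num = solve-∀
    den≡-1 : + q ∣ℤ den ⟦ 0F ⟧ ⟦ kF ⟧ ⟦ kF ⟧ + + 1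
    den≡-1 = subst₂ (λ Z K → + q ∣ℤ den Z K K + + 1) (sym (⟦mod⟧≡ 0<q)) (sym (⟦mod⟧≡ k<q))
      (divides (+ k) (trans (den+1 (+ k)) (cong (+ k *_) (sym q≡2[k+k]))))
    h≡2k : + q ∣ℤ ⟦ h ⟧ + num ⟦ 0F ⟧ ⟦ kF ⟧ ⟦ kF ⟧
    h≡2k = subst₂ (λ Z K → + q ∣ℤ ⟦ h ⟧ + num Z K K) (sym (⟦mod⟧≡ 0<q)) (sym (⟦mod⟧≡ k<q))
      (subst (λ H → + q ∣ℤ H + num (+ 0) (+ k) (+ k)) (sym (trans (⟦mod⟧≡ q/2<q) (cong +_ h≡k+k)))
        (divides (+ 0) (h+num (+ k) (+ q))))

  twist-periodic-solution : ∀ {ψ : Fin q → Sign} → FunEq q ψ → ψ (0 mod q) ≡ Sign.+ →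
    ∀ r → twist r ψ (q / 2 mod q) ≡ Sign.+ → FunEq q (twist r ψ) × Periodic-half q (twist r ψ)
  twist-periodic-solution {ψ} ψ-eq ψ0 r χh =
    FunEq-twist 2∣q ψ-eq r , χ[q/2]≡+⇒Periodic-half (FunEq-twist 2∣q ψ-eq r) (twist-at-0 {ψ = ψ} ψ0 r) χh

lemma7p9 : (q : ℕ) .{{_ : NonZero q}} → 2 ∣ q →
    (ψ : Fin q → Sign) → ψ (0 mod q) ≡ Sign.+ → FunEq q ψ →
    ∃[ r ] (r ≤ 1 × FunEq q (twist r ψ) × Periodic-half q (twist r ψ))
lemma7p9 q 2∣q ψ ψ0 ψ-eq with ψ (q / 2 mod q) in ψh
... | Sign.+ = 0 , z≤n , twist-periodic-solution 2∣q ψ-eq ψ0 0 (cong (Sign._* Sign.+) ψh)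
... | Sign.- with even-or-odd (q / 2)
...   | k , inj₁ h≡k+k =
      ⊥-elim (Sign.s≢opposite[s] Sign.- (trans (sym ψh) (q/2-even⇒ψ[q/2]≡+ 2∣q ψ-eq ψ0 k h≡k+k)))
...   | k , inj₂ h≡1+k+k = 1 , s≤s z≤n , twist-periodic-solution 2∣q ψ-eq ψ0 1 (begin
      twist 1 ψ (q / 2 mod q)
        ≡⟨ twist-at-half 1 ψ ⟩
      ψ (q / 2 mod q) Sign.* negOnePow (1 ℕ.* (q / 2))
        ≡⟨ cong₂ Sign._*_ ψh (cong negOnePow (trans (ℕ.*-identityˡ _) h≡1+k+k)) ⟩
      Sign.- Sign.* (Sign.- Sign.* negOnePow (k ℕ.+ k))
        ≡⟨ cong (λ s → Sign.- Sign.* (Sign.- Sign.* s)) (negOnePow-double k) ⟩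
      Sign.+ ∎)
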